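{- For all integers $n_1\ge n_2\ge\dots\ge n_d\ge 2$, $$\Big\lfloor\frac{n_1}{2}\Big\rfloor\prod_{i=2}^{d}\big\lfloor\sqrt{n_i}\big\rfloor\ \le\ \eta(K_{n_1}\,\square\,K_{n_2}\,\square\,\cdots\,\square\,K_{n_d})\ <\ \sqrt d\, n_1\prod_{i=2}^d\sqrt{n_i}+3.$$
   Context: All graphs are finite, simple and undirected. $K_n$ is the complete graph on $n$ vertices. The Cartesian product $G\,\square\,H$ has vertex set $V(G)\times V(H)$, with $(v,x)(w,y)$ an edge iff ($vw\in E(G)$ and $x=y$) or ($v=w$ and $xy\in E(H)$); it is associative. $\eta(G)$ is the maximum $k$ such that $K_k$ is a minor of $G$. -}

module Defs where

open import Data.Nat using (ℕ; zero; suc; _*_; _^_; _≤ᵇ_)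
open import Data.Bool using (if_then_else_)
open import Data.Fin using (Fin)
open import Data.Maybe using (Maybe; just)
open import Data.Product using (_×_; ∃; ∃-syntax; _,_)
open import Data.Sum using (_⊎_; inj₁; inj₂)
open import Data.List using (List; []; _∷_; foldr)
open import Relation.Binary.PropositionalEquality using (_≡_; _≢_; refl)
open import Relation.Nullary using (¬_)

record Graph : Set₁ where
  field
    V     : Set
    E     : V → V → Set
    sym   : ∀ {u v} → E u v → E v u
    irrefl : ∀ {u} → ¬ E u u
open Graph public

K : ℕ → Graph
K n = record
  { V = Fin n
  ; E = λ x y → x ≢ y
  ; sym = λ p q → p (Data.Product.proj₁ (q-sym q))
  ; irrefl = λ p → p _≡_.refl
  }
  where
  q-sym : ∀ {x y : Fin n} → y ≡ x → (x ≡ y) × (x ≡ y)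
  q-sym _≡_.refl = _≡_.refl , _≡_.refl

□E : (G H : Graph) → V G × V H → V G × V H → Set
□E G H (v , x) (w , y) = (E G v w × x ≡ y) ⊎ (v ≡ w × E H x y)

□sym : (G H : Graph) → ∀ {p q} → □E G H p q → □E G H q p
□sym G H {v , x} {w , y} (inj₁ (e , refl)) = inj₁ (sym G e , refl)
□sym G H {v , x} {w , y} (inj₂ (refl , e)) = inj₂ (refl , sym H e)

□irr : (G H : Graph) → ∀ {p} → ¬ □E G H p p
□irr G H {v , x} (inj₁ (e , _)) = irrefl G e
□irr G H {v , x} (inj₂ (_ , e)) = irrefl H e

_□_ : Graph → Graph → Graph
G □ H = record { V = V G × V H ; E = □E G H ; sym = □sym G H ; irrefl = □irr G H }

-- K_{n₁} □ K_{m₁} □ ... □ K_{mₖ}  (right-nested; □ is associative)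
prodK : ℕ → List ℕ → Graph
prodK n₁ []       = K n₁
prodK n₁ (m ∷ ms) = K n₁ □ prodK m ms

data PathIn (G : Graph) (S : V G → Set) : V G → V G → Set where
  here : ∀ {u} → S u → PathIn G S u u
  step : ∀ {u w v} → S u → E G u w → PathIn G S w v → PathIn G S u v

-- A K_k minor model: branch-set assignment β (nothing = vertex deleted),
-- which makes branch sets pairwise disjoint; each branch set is nonempty,
-- connected, and any two distinct branch sets are joined by an edge.
record KMinorModel (k : ℕ) (G : Graph) : Set where
  field
    β         : V G → Maybe (Fin k)
    nonempty  : ∀ i → ∃[ v ] (β v ≡ just i)
    connected : ∀ i {u v} → β u ≡ just i → β v ≡ just i →
                PathIn G (λ w → β w ≡ just i) u v
    adjacent  : ∀ i j → i ≢ j →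
                ∃[ u ] ∃[ v ] (β u ≡ just i × β v ≡ just j × E G u v)

HasKMinor : ℕ → Graph → Set
HasKMinor k G = KMinorModel k G

⌊√_⌋ : ℕ → ℕ
⌊√ zero ⌋  = 0
⌊√ suc n ⌋ = if (suc r ^ 2) ≤ᵇ suc n then suc r else r
  where r = ⌊√ n ⌋

prod : List ℕ → ℕ
prod = foldr _*_ 1

module Submission where

-- If a graph has at most N vertices and maximum degree
-- at most D, then a K_k minor yields, for every ordered pair of distinct branch sets,
-- an edge leaving the first one towards the second; its tail vertex determines the
-- first branch set and its head the second, so k(k-1) ≤ N·D.  For the product,
-- N = n₁ ∏ nᵢ and D ≤ d·n₁, hence (k-3)² < k(k-1) ≤ d·n₁²·∏ nᵢ.
--
-- K_m contains an s×s "grid" (an embedded s×s array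
-- of vertices whose rows and columns are connected) whenever s² ≤ m, and products of
-- grids are grids, so K_{n₂} □ … □ K_{n_d} contains a grid of side ∏ ⌊√nᵢ⌋.  Given a
-- grid of side s in H, pair the copies of H in K_n □ H as (2i, 2i+1) for i < ⌊n/2⌋ and
-- take as branch set (i, p) row p in copy 2i together with column p in copy 2i+1; any
-- two branch sets (i, p), (j, r) meet across the K_n-edge at grid cell (p, r).

open import Defs hiding (sym)
open import Data.Nat using (ℕ; suc; _*_; _^_; _∸_; _≤_; _<_; _≥_; _/_)
open import Data.List using (List; _∷_; map; length)
open import Data.List.Relation.Unary.All using (All)
open import Data.List.Relation.Unary.Linked using (Linked)
open import Data.Product using (_×_)

open import Data.Nat using (zero; _+_; z≤n; s≤s; _<?_; _≤ᵇ_)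
open import Data.Nat.Properties
  using (≤-refl; ≤-reflexive; ≤-trans; <-≤-trans; n≤1+n; m≤n+m; +-mono-≤; *-mono-≤;
         *-identityʳ; +-identityʳ; ≤ᵇ⇒≤)
open import Data.Nat.DivMod using (m/n*n≤m; m/n≤m)
open import Data.Nat.ListAction using (sum)
open import Data.Nat.Solver using (module +-*-Solver)
open import Data.Fin using (Fin; toℕ; fromℕ<; inject≤; combine; remQuot; punchIn; _↑ˡ_; _↑ʳ_; splitAt)
open import Data.Fin.Patterns using (0F; 1F)
open import Data.Fin.Properties
  using (toℕ-injective; toℕ-fromℕ<; toℕ-inject≤; toℕ<n; inject≤-injective; combine-injective;
         combine-remQuot; ↑ˡ-injective; ↑ʳ-injective; splitAt-↑ˡ; splitAt-↑ʳ;
         punchIn-injective; punchInᵢ≢i; injective⇒≤; _≟_; *↔×)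
open import Data.Bool using (true; false; if_then_else_; T)
open import Data.Unit using (tt)
open import Data.Maybe using (Maybe; just; nothing; zipWith)
open import Data.Maybe.Properties using (just-injective)
open import Data.Product using (∃-syntax; _,_; proj₁; proj₂; curry; uncurry)
open import Data.Sum using (inj₁; inj₂)
open import Data.List using ([])
open import Data.List.Relation.Unary.All using ([]; _∷_)
open import Data.List.Relation.Unary.Linked.Properties using (Linked⇒All)
open import Data.Product.Function.NonDependent.Propositional using (_×-↔_)
open import Function using (_∘_; flip)
open import Function.Bundles using (_↔_; Inverse; mk↔ₛ′)
open import Function.Properties.Inverse using (↔-refl; ↔-trans)
open import Relation.Binary.PropositionalEquality
  using (_≡_; _≢_; refl; sym; trans; cong; cong₂; subst)
open import Relation.Nullary using (yes; no)
open import Data.Empty using (⊥-elim)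

_++ₚ_ : ∀ {G S u v w} → PathIn G S u v → PathIn G S v w → PathIn G S u w
here _     ++ₚ q = q
step s e p ++ₚ q = step s e (p ++ₚ q)

start : ∀ {G S u v} → PathIn G S u v → S u
start (here s)     = s
start (step s _ _) = s

reverseₚ : ∀ {G S u v} → PathIn G S u v → PathIn G S v u
reverseₚ     (here s)     = here s
reverseₚ {G} (step s e p) = reverseₚ p ++ₚ step (start p) (Graph.sym G e) (here s)

mapₚ : ∀ {G H : Graph} {S : V G → Set} {S' : V H → Set} (f : V G → V H) →
       (∀ {u v} → E G u v → E H (f u) (f v)) → (∀ {u} → S u → S' (f u)) →
       ∀ {u v} → PathIn G S u v → PathIn H S' (f u) (f v)
mapₚ f hom inS (here s)     = here (inS s)
mapₚ f hom inS (step s e p) = step (inS s) (hom e) (mapₚ f hom inS p)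

viaHub : ∀ {G S} (h : V G) → (∀ {u} → S u → PathIn G S u h) →
         ∀ {u v} → S u → S v → PathIn G S u v
viaHub h toHub su sv = toHub su ++ₚ reverseₚ (toHub sv)

completeₚ : ∀ {n} {S : Fin n → Set} {u v} → S u → S v → PathIn (K n) S u v
completeₚ {u = u} {v} su sv with u ≟ v
... | yes refl = here su
... | no u≢v   = step su u≢v (here sv)

-- G has at most N vertices (an injective index) and degree at most D (at each vertex,
-- the incident edges are told apart by a port in Fin D).
record Bounded (G : Graph) (N D : ℕ) : Set where
  field
    index           : V G → Fin N
    index-injective : ∀ {u v} → index u ≡ index v → u ≡ v
    port            : ∀ {u v} → E G u v → Fin D
    port-injective  : ∀ {u v v'} (e : E G u v) (e' : E G u v') → port e ≡ port e' → v ≡ v'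

bounded-K : ∀ n → Bounded (K n) n n
bounded-K n = record
  { index = λ x → x ; index-injective = λ eq → eq
  ; port = λ {_} {v} _ → v ; port-injective = λ _ _ eq → eq }

bounded-resize : ∀ {G N D N' D'} → N ≤ N' → D ≤ D' → Bounded G N D → Bounded G N' D'
bounded-resize N≤N' D≤D' B = record
  { index = λ v → inject≤ (index v) N≤N'
  ; index-injective = index-injective ∘ inject≤-injective N≤N' N≤N' _ _
  ; port = λ e → inject≤ (port e) D≤D'
  ; port-injective = λ e e' → port-injective e e' ∘ inject≤-injective D≤D' D≤D' _ _ }
  where open Bounded B

bounded-□ : ∀ {G H N D N' D'} → Bounded G N D → Bounded H N' D' → Bounded (G □ H) (N * N') (D + D')
bounded-□ {G} {H} {N} {D} {N'} {D'} BG BH = record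
  { index = λ (v , w) → combine (G.index v) (H.index w)
  ; index-injective = index-injective
  ; port = port
  ; port-injective = port-injective }
  where
  module G = Bounded BG
  module H = Bounded BH

  index-injective : ∀ {u v : V (G □ H)} →
                    combine (G.index (proj₁ u)) (H.index (proj₂ u)) ≡
                    combine (G.index (proj₁ v)) (H.index (proj₂ v)) → u ≡ v
  index-injective eq with combine-injective _ _ _ _ eq
  ... | eq₁ , eq₂ = cong₂ _,_ (G.index-injective eq₁) (H.index-injective eq₂)

  port : ∀ {u v} → E (G □ H) u v → Fin (D + D')
  port (inj₁ (e , _)) = G.port e ↑ˡ D'
  port (inj₂ (_ , e)) = D ↑ʳ H.port e

  halves-disjoint : ∀ (i : Fin D) (j : Fin D') → i ↑ˡ D' ≢ D ↑ʳ j
  halves-disjoint i j eq with trans (sym (splitAt-↑ˡ D i D')) (trans (cong (splitAt D) eq) (splitAt-↑ʳ D D' j))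
  ... | ()

  port-injective : ∀ {u v v'} (e : E (G □ H) u v) (e' : E (G □ H) u v') → port e ≡ port e' → v ≡ v'
  port-injective (inj₁ (e , refl)) (inj₁ (e' , refl)) eq =
    cong (_, _) (G.port-injective e e' (↑ˡ-injective D' _ _ eq))
  port-injective (inj₂ (refl , e)) (inj₂ (refl , e')) eq =
    cong (_ ,_) (H.port-injective e e' (↑ʳ-injective D _ _ eq))
  port-injective (inj₁ (e , _)) (inj₂ (_ , e')) eq = ⊥-elim (halves-disjoint _ _ eq)
  port-injective (inj₂ (_ , e)) (inj₁ (e' , _)) eq = ⊥-elim (halves-disjoint _ _ (sym eq))

bounded-prodK : ∀ n ms → Bounded (prodK n ms) (n * prod ms) (sum (n ∷ ms))
bounded-prodK n []       =
  bounded-resize (≤-reflexive (sym (*-identityʳ n))) (≤-reflexive (sym (+-identityʳ n))) (bounded-K n)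
bounded-prodK n (m ∷ ms) = bounded-□ (bounded-K n) (bounded-prodK m ms)

sum≤length*bound : ∀ {B} xs → All (_≤ B) xs → sum xs ≤ length xs * B
sum≤length*bound []       []         = z≤n
sum≤length*bound (x ∷ xs) (x≤B ∷ ps) = +-mono-≤ x≤B (sum≤length*bound xs ps)

injective-×⇒≤ : ∀ {a b c d} (f : Fin a × Fin b → Fin c × Fin d) →
                (∀ {x y} → f x ≡ f y → x ≡ y) → a * b ≤ c * d
injective-×⇒≤ {a} {b} {c} {d} f f-injective =
  injective⇒≤ {f = uncurry combine ∘ f ∘ remQuot b} (remQuot-injective ∘ f-injective ∘ combine-injective′)
  where
  combine-injective′ : ∀ {p q : Fin c × Fin d} → uncurry combine p ≡ uncurry combine q → p ≡ q
  combine-injective′ eq with combine-injective _ _ _ _ eq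
  ... | eq₁ , eq₂ = cong₂ _,_ eq₁ eq₂

  remQuot-injective : ∀ {x y : Fin (a * b)} → remQuot b x ≡ remQuot b y → x ≡ y
  remQuot-injective {x} {y} eq =
    trans (sym (combine-remQuot {a} b x)) (trans (cong (uncurry combine) eq) (combine-remQuot {a} b y))

-- If G has at most N vertices and degree at most D, then a K_{k+1} minor has (k+1)·k ≤ N·D:
-- the edge from branch set i to its j-th other branch set `punchIn i j` is determined
-- by its tail vertex and its port, and determines (i, j).
minorSize : ∀ {G N D k} → Bounded G N D → KMinorModel (suc k) G → suc k * k ≤ N * D
minorSize {G} {N} {D} {k} B M = injective-×⇒≤ code code-injective
  where
  open Bounded B
  open KMinorModel M

  record Link (i j : Fin (suc k)) : Set where
    constructor link
    pattern
    field
      tail head : V G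
      tail∈     : β tail ≡ just i
      head∈     : β head ≡ just j
      edge      : E G tail head

  links : (i : Fin (suc k)) (j : Fin k) → Link i (punchIn i j)
  links i j with adjacent i (punchIn i j) (punchInᵢ≢i i j ∘ sym)
  ... | u , v , βu , βv , e = link u v βu βv e

  code : Fin (suc k) × Fin k → Fin N × Fin D
  code (i , j) = index (Link.tail l) , port (Link.edge l)
    where l = links i j

  sameLink : ∀ {i j i' j'} (l : Link i j) (l' : Link i' j') →
             index (Link.tail l) ≡ index (Link.tail l') → port (Link.edge l) ≡ port (Link.edge l') →
             i ≡ i' × j ≡ j'
  sameLink (link u v βu βv e) (link u' v' βu' βv' e') same-index same-port
    with index-injective same-index
  ... | refl = just-injective (trans (sym βu) βu')
             , just-injective (trans (sym βv) (trans (cong β (port-injective e e' same-port)) βv'))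

  code-injective : ∀ {x y} → code x ≡ code y → x ≡ y
  code-injective {i , j} {i' , j'} eq
    with sameLink (links i j) (links i' j') (cong proj₁ eq) (cong proj₂ eq)
  ... | refl , same-partner = cong (i ,_) (punchIn-injective i j j' same-partner)

prod-positive : ∀ ns → All (2 ≤_) ns → 0 < prod ns
prod-positive []       []           = s≤s z≤n
prod-positive (m ∷ ms) (2≤m ∷ 2≤ms) = *-mono-≤ (≤-trans (n≤1+n 1) 2≤m) (prod-positive ms 2≤ms)

-- The right-hand side d·n₁²·∏nᵢ of the upper bound is positive (n₁² is ∏[n₁, n₁]).
bound-positive : ∀ n₁ ns → All (2 ≤_) (n₁ ∷ ns) → 0 < suc (length ns) * (n₁ ^ 2) * prod ns
bound-positive n₁ ns (2≤n₁ ∷ 2≤ns) =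
  *-mono-≤ (*-mono-≤ (s≤s (z≤n {length ns})) (prod-positive (n₁ ∷ n₁ ∷ []) (2≤n₁ ∷ 2≤n₁ ∷ [])))
           (prod-positive ns 2≤ns)

open +-*-Solver using (solve; _:*_; _:=_; con)

-- The upper bound of the theorem.  For k ≥ 3, write k = m + 3: then m² < (m+3)(m+2)
-- ≤ |V|·(degree bound) = n₁∏nᵢ · d·n₁.  For k ≤ 2 the left side is 0.
upperBound : ∀ n₁ ns → All (2 ≤_) (n₁ ∷ ns) → Linked _≥_ (n₁ ∷ ns) →
             ∀ k → HasKMinor k (prodK n₁ ns) →
             (k ∸ 3) ^ 2 < suc (length ns) * (n₁ ^ 2) * prod ns
upperBound n₁ ns (2≤n₁ ∷ 2≤ns) n₁≥ns (suc (suc (suc m))) M =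
  <-≤-trans square<
    (≤-trans (minorSize bounded M) (≤-reflexive (rearrange n₁ (prod ns) (suc (length ns)))))
  where
  entries≤n₁ : All (_≤ n₁) (n₁ ∷ ns)
  entries≤n₁ = Linked⇒All (λ p q → ≤-trans q p) ≤-refl n₁≥ns

  bounded : Bounded (prodK n₁ ns) (n₁ * prod ns) (suc (length ns) * n₁)
  bounded = bounded-resize ≤-refl (sum≤length*bound (n₁ ∷ ns) entries≤n₁) (bounded-prodK n₁ ns)

  square< : m ^ 2 < suc (suc (suc m)) * suc (suc m)
  square< rewrite *-identityʳ m =
    s≤s (≤-trans (*-mono-≤ (m≤n+m m 2) (m≤n+m m 2)) (m≤n+m _ (suc m)))

  rearrange : ∀ n P d → n * P * (d * n) ≡ d * (n ^ 2) * P
  rearrange = solve 3 (λ n P d → n :* P :* (d :* n) := d :* (n :* (n :* con 1)) :* P) refl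
upperBound n₁ ns entries≥2 _ 0 _ = bound-positive n₁ ns entries≥2
upperBound n₁ ns entries≥2 _ 1 _ = bound-positive n₁ ns entries≥2
upperBound n₁ ns entries≥2 _ 2 _ = bound-positive n₁ ns entries≥2

record Embedding (A B : Set) : Set where
  field
    embed        : A → B
    decode       : B → Maybe A
    decode-embed : ∀ a → decode (embed a) ≡ just a
    embed-decode : ∀ {b a} → decode b ≡ just a → embed a ≡ b

  embed-injective : ∀ {a a'} → embed a ≡ embed a' → a ≡ a'
  embed-injective {a} {a'} eq =
    just-injective (trans (sym (decode-embed a)) (trans (cong decode eq) (decode-embed a')))

open Embedding

initialSegment : ∀ {m n} → m ≤ n → Embedding (Fin m) (Fin n)
initialSegment {m} {n} m≤n = record
  { embed = embedᵢ ; decode = decodeᵢ ; decode-embed = decode-embed′ ; embed-decode = embed-decode′ }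
  where
  embedᵢ : Fin m → Fin n
  embedᵢ i = inject≤ i m≤n

  decodeᵢ : Fin n → Maybe (Fin m)
  decodeᵢ x with toℕ x <? m
  ... | yes x<m = just (fromℕ< x<m)
  ... | no  _   = nothing

  decode-embed′ : ∀ i → decodeᵢ (embedᵢ i) ≡ just i
  decode-embed′ i with toℕ (embedᵢ i) <? m
  ... | yes x<m = cong just (toℕ-injective (trans (toℕ-fromℕ< x<m) (toℕ-inject≤ i m≤n)))
  ... | no  x≮m = ⊥-elim (x≮m (subst (_< m) (sym (toℕ-inject≤ i m≤n)) (toℕ<n i)))

  embed-decode′ : ∀ {x i} → decodeᵢ x ≡ just i → embedᵢ i ≡ x
  embed-decode′ {x} eq with toℕ x <? m
  embed-decode′ {x} refl | yes x<m = toℕ-injective (trans (toℕ-inject≤ _ m≤n) (toℕ-fromℕ< x<m))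

reindex : ∀ {A A' B : Set} → A ↔ A' → Embedding A B → Embedding A' B
reindex {A} {A'} {B} A↔A' e = record
  { embed = embed e ∘ from ; decode = decodeᵣ ; decode-embed = decode-embed′ ; embed-decode = embed-decode′ }
  where
  open Inverse A↔A'

  decodeᵣ : B → Maybe A'
  decodeᵣ b with decode e b
  ... | just a  = just (to a)
  ... | nothing = nothing

  decode-embed′ : ∀ a' → decodeᵣ (embed e (from a')) ≡ just a'
  decode-embed′ a' rewrite decode-embed e (from a') = cong just (strictlyInverseˡ a')

  embed-decode′ : ∀ {b a'} → decodeᵣ b ≡ just a' → embed e (from a') ≡ b
  embed-decode′ {b} eq with decode e b in eqₑ
  embed-decode′ {b} refl | just a rewrite strictlyInverseʳ a = embed-decode e eqₑ

_×ₑ_ : ∀ {A B C D : Set} → Embedding A B → Embedding C D → Embedding (A × C) (B × D)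
_×ₑ_ {A} {B} {C} {D} e f = record
  { embed = λ (a , c) → embed e a , embed f c
  ; decode = λ (b , d) → zipWith _,_ (decode e b) (decode f d)
  ; decode-embed = λ (a , c) → cong₂ (zipWith _,_) (decode-embed e a) (decode-embed f c)
  ; embed-decode = embed-decode′ }
  where
  embed-decode′ : ∀ {bd ac} → zipWith _,_ (decode e (proj₁ bd)) (decode f (proj₂ bd)) ≡ just ac →
                  (embed e (proj₁ ac) , embed f (proj₂ ac)) ≡ bd
  embed-decode′ {b , d} eq with decode e b in eqₑ | decode f d in eq_f
  embed-decode′ {b , d} refl | just a | just c = cong₂ _,_ (embed-decode e eqₑ) (embed-decode f eq_f)

Row : ∀ {W I : Set} → (I → I → W) → I → W → Set
Row f p w = ∃[ c ] f p c ≡ w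

RowsConnected : (H : Graph) {I : Set} → (I → I → V H) → Set
RowsConnected H f = ∀ p q r → PathIn H (Row f p) (f p q) (f p r)

record Grid (H : Graph) (I : Set) : Set where
  field
    cell    : Embedding (I × I) (V H)
    rows    : RowsConnected H (curry (embed cell))
    columns : RowsConnected H (flip (curry (embed cell)))

_⊠_ : ∀ {G H : Graph} {I J : Set} → (I → I → V G) → (J → J → V H) → (I × J → I × J → V (G □ H))
(f ⊠ g) a b = f (proj₁ a) (proj₁ b) , g (proj₂ a) (proj₂ b)

rowsConnected-⊠ : ∀ {G H : Graph} {I J : Set} {f : I → I → V G} {g : J → J → V H} →
                  RowsConnected G f → RowsConnected H g → RowsConnected (G □ H) (_⊠_ {G} {H} f g)
rowsConnected-⊠ {f = f} {g} rowsG rowsH (p , p') (q , q') (r , r') =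
  mapₚ (_, g p' q') (λ e → inj₁ (e , refl)) (λ (c , eq) → (c , q') , cong (_, g p' q') eq) (rowsG p q r)
  ++ₚ mapₚ (f p r ,_) (λ e → inj₂ (refl , e)) (λ (c , eq) → (r , c) , cong (f p r ,_) eq) (rowsH p' q' r')

shuffle : ∀ {I J : Set} → ((I × I) × (J × J)) ↔ ((I × J) × (I × J))
shuffle = mk↔ₛ′ (λ ((p , q) , (p' , q')) → (p , p') , (q , q'))
                (λ ((p , p') , (q , q')) → (p , q) , (p' , q'))
                (λ _ → refl) (λ _ → refl)

-- Products of grids are grids (transposing commutes with ⊠, so columns are rows again).
grid-□ : ∀ {G H : Graph} {I J : Set} → Grid G I → Grid H J → Grid (G □ H) (I × J)
grid-□ gridG gridH = record
  { cell    = reindex shuffle (cell gridG ×ₑ cell gridH)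
  ; rows    = rowsConnected-⊠ (rows gridG) (rows gridH)
  ; columns = rowsConnected-⊠ (columns gridG) (columns gridH) }
  where open Grid

grid-K : ∀ {s m} → s * s ≤ m → Grid (K m) (Fin s)
grid-K s*s≤m = record
  { cell    = reindex *↔× (initialSegment s*s≤m)
  ; rows    = λ p q r → completeₚ (q , refl) (r , refl)
  ; columns = λ p q r → completeₚ (q , refl) (r , refl) }

record SizedGrid (H : Graph) (s : ℕ) : Set₁ where
  field
    Index : Set
    grid  : Grid H Index
    size  : Fin s ↔ Index

sizedGrid-K : ∀ {s m} → s * s ≤ m → SizedGrid (K m) s
sizedGrid-K s*s≤m = record { Index = _ ; grid = grid-K s*s≤m ; size = ↔-refl }

sizedGrid-□ : ∀ {G H s t} → SizedGrid G s → SizedGrid H t → SizedGrid (G □ H) (s * t)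
sizedGrid-□ gridG gridH = record
  { Index = _ ; grid = grid-□ (grid gridG) (grid gridH) ; size = ↔-trans *↔× (size gridG ×-↔ size gridH) }
  where open SizedGrid

⌊√⌋²≤ : ∀ n → ⌊√ n ⌋ * ⌊√ n ⌋ ≤ n
⌊√⌋²≤ zero    = z≤n
⌊√⌋²≤ (suc n) = next ⌊√ n ⌋ (⌊√⌋²≤ n)
  where
  next : ∀ r → r * r ≤ n →
         let r' = if suc r ^ 2 ≤ᵇ suc n then suc r else r in r' * r' ≤ suc n
  next r r²≤n with suc r ^ 2 ≤ᵇ suc n in test
  ... | true  = subst (_≤ suc n) (cong (suc r *_) (*-identityʳ (suc r)))
                      (≤ᵇ⇒≤ (suc r ^ 2) (suc n) (subst T (sym test) tt))
  ... | false = ≤-trans r²≤n (n≤1+n n)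

sizedGrid-prodK : ∀ m ms → SizedGrid (prodK m ms) (prod (map ⌊√_⌋ (m ∷ ms)))
sizedGrid-prodK m []        =
  sizedGrid-K (subst (_≤ m) (sym (cong₂ _*_ (*-identityʳ ⌊√ m ⌋) (*-identityʳ ⌊√ m ⌋))) (⌊√⌋²≤ m))
sizedGrid-prodK m (m' ∷ ms) = sizedGrid-□ (sizedGrid-K {⌊√ m ⌋} (⌊√⌋²≤ m)) (sizedGrid-prodK m' ms)

record MinorModel (X : Set) (G : Graph) : Set where
  field
    β         : V G → Maybe X
    nonempty  : ∀ x → ∃[ v ] (β v ≡ just x)
    connected : ∀ x {u v} → β u ≡ just x → β v ≡ just x → PathIn G (λ w → β w ≡ just x) u v
    adjacent  : ∀ x y → x ≢ y → ∃[ u ] ∃[ v ] (β u ≡ just x × β v ≡ just y × E G u v)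

relabel : ∀ {k X G} → Fin k ↔ X → MinorModel X G → KMinorModel k G
relabel {k} {X} {G} k↔X M = record
  { β = β′
  ; nonempty = λ i → let (v , βv) = nonempty (to i) in v , β′-just βv
  ; connected = λ i βu βv →
      mapₚ (λ w → w) (λ e → e) β′-just (connected (to i) (just-β′ βu) (just-β′ βv))
  ; adjacent = λ i j i≢j →
      let (u , v , βu , βv , e) = adjacent (to i) (to j) (i≢j ∘ to-injective)
      in u , v , β′-just βu , β′-just βv , e }
  where
  open Inverse k↔X
  open MinorModel M

  β′ : V G → Maybe (Fin k)
  β′ v with β v
  ... | just x  = just (from x)
  ... | nothing = nothing

  β′-just : ∀ {v i} → β v ≡ just (to i) → β′ v ≡ just i
  β′-just {v} {i} eq rewrite eq = cong just (strictlyInverseʳ i)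

  just-β′ : ∀ {v i} → β′ v ≡ just i → β v ≡ just (to i)
  just-β′ {v} eq with β v
  just-β′ refl | just x = cong just (sym (strictlyInverseˡ x))

  to-injective : ∀ {i j} → to i ≡ to j → i ≡ j
  to-injective {i} {j} eq = trans (sym (strictlyInverseʳ i)) (trans (cong from eq) (strictlyInverseʳ j))

completeMinor : ∀ {X n} → Embedding X (Fin n) → MinorModel X (K n)
completeMinor e = record
  { β = decode e
  ; nonempty = λ x → embed e x , decode-embed e x
  ; connected = λ x βu βv → completeₚ βu βv
  ; adjacent = λ x y x≢y → embed e x , embed e y , decode-embed e x , decode-embed e y
                           , x≢y ∘ embed-injective e }

-- Copy (i, 0) of H ↔ vertex 2i of K_n, copy (i, 1) ↔ 2i+1; branch set (i, p) is row p of
-- copy (i, 0) together with column p of copy (i, 1).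
gridMinor : ∀ {H : Graph} {s} n → SizedGrid H s → KMinorModel ((n / 2) * s) (K n □ H)
gridMinor {H} n sized = relabel (↔-trans *↔× (↔-refl ×-↔ size)) model
  where
  open SizedGrid sized
  open Grid grid
  a = n / 2

  copies : Embedding (Fin a × Fin 2) (Fin n)
  copies = reindex *↔× (initialSegment (m/n*n≤m n 2))

  copy : Fin a → Fin 2 → Fin n
  copy i b = embed copies (i , b)

  at : Index → Index → V H
  at = curry (embed cell)

  pick : Fin 2 → Index × Index → Index
  pick 0F = proj₁
  pick 1F = proj₂

  β : V (K n □ H) → Maybe (Fin a × Index)
  β (x , w) = zipWith (λ (i , b) pq → i , pick b pq) (decode copies x) (decode cell w)

  β-cell : ∀ i b pq → β (copy i b , embed cell pq) ≡ just (i , pick b pq)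
  β-cell i b pq rewrite decode-embed copies (i , b) | decode-embed cell pq = refl

  β-inverse : ∀ {x w i p} → β (x , w) ≡ just (i , p) →
              ∃[ b ] ∃[ pq ] (x ≡ copy i b × w ≡ embed cell pq × pick b pq ≡ p)
  β-inverse {x} {w} eq with decode copies x in eqₓ | decode cell w in eq_w
  β-inverse refl | just (i , b) | just pq =
    b , pq , sym (embed-decode copies eqₓ) , sym (embed-decode cell eq_w) , refl

  copies-distinct : ∀ i j → copy i 1F ≢ copy j 0F
  copies-distinct i j eq with cong proj₂ (embed-injective copies eq)
  ... | ()

  Branch : Fin a × Index → V (K n □ H) → Set
  Branch ip v = β v ≡ just ip

  hub : Fin a × Index → V (K n □ H)
  hub (i , p) = copy i 0F , at p p

  -- row p of copy (i, 0) is walked directly; from column p of copy (i, 1) walk to cell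
  -- (p, p) and cross the K_n-edge to copy (i, 0)
  toHub : ∀ {i p v} → Branch (i , p) v → PathIn (K n □ H) (Branch (i , p)) v (hub (i , p))
  toHub {i} βv with β-inverse βv
  ... | 0F , (p , c) , refl , refl , refl =
    mapₚ (copy i 0F ,_) (λ e → inj₂ (refl , e)) (λ { (c' , refl) → β-cell i 0F (p , c') }) (rows p c p)
  ... | 1F , (r , p) , refl , refl , refl =
    mapₚ (copy i 1F ,_) (λ e → inj₂ (refl , e)) (λ { (r' , refl) → β-cell i 1F (r' , p) }) (columns p r p)
    ++ₚ step (β-cell i 1F (p , p)) (inj₁ (copies-distinct i i , refl)) (here (β-cell i 0F (p , p)))

  model : MinorModel (Fin a × Index) (K n □ H)
  model = record
    { β = β
    ; nonempty = λ (i , p) → hub (i , p) , β-cell i 0F (p , p)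
    ; connected = λ ip → viaHub (hub ip) toHub
    ; adjacent = λ (i , p) (j , r) _ →
        (copy i 0F , at p r) , (copy j 1F , at p r) , β-cell i 0F (p , r) , β-cell j 1F (p , r)
        , inj₁ ((λ eq → copies-distinct j i (sym eq)) , refl) }

lowerBound : ∀ n₁ ns → HasKMinor ((n₁ / 2) * prod (map ⌊√_⌋ ns)) (prodK n₁ ns)
lowerBound n₁ []       =
  relabel ↔-refl (completeMinor (initialSegment (≤-trans (≤-reflexive (*-identityʳ _)) (m/n≤m n₁ 2))))
lowerBound n₁ (m ∷ ms) = gridMinor n₁ (sizedGrid-prodK m ms)

mainTheorem8 : (n₁ : ℕ) (ns : List ℕ) →
    All (2 ≤_) (n₁ ∷ ns) → Linked _≥_ (n₁ ∷ ns) →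
    HasKMinor ((n₁ / 2) * prod (map ⌊√_⌋ ns)) (prodK n₁ ns)
    × (∀ k → HasKMinor k (prodK n₁ ns) →
         (k ∸ 3) ^ 2 < suc (length ns) * (n₁ ^ 2) * prod ns)
mainTheorem8 n₁ ns entries≥2 nonIncreasing = lowerBound n₁ ns , upperBound n₁ ns entries≥2 nonIncreasing
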